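{- Let $\kappa\ge 1$ and let $L_1,\ldots,L_{\kappa-1}$ be $\kappa-1$ pairwise projective Latin squares of order $\kappa$ on the symbol set $\{1,\ldots,\kappa\}$, with $L_t = [l^{(t)}_{rc}]$. Let $i \neq j$ be two column indices in $\{1,\ldots,\kappa\}$. Then the $\kappa(\kappa-1)$ ordered pairs $(l^{(t)}_{ri}, l^{(t)}_{rj})$, $1\le t\le \kappa-1$, $1\le r\le\kappa$, are exactly all the $\kappa(\kappa-1)$ ordered pairs $(x,y)$ of distinct elements $x\neq y$ of $\{1,\ldots,\kappa\}$.
   Context: A Latin square of order $\kappa$ is a $\kappa\times\kappa$ array with entries in $\{1,\ldots,\kappa\}$ in which every symbol occurs exactly once in each row and exactly once in each column. Two Latin squares $L = [l_{ij}]$ and $L' = [l'_{ij}]$ of order $\kappa$ are called projective if all diagonal entries of both are equal to $1$, and for every row index $r$ of $L$ and every row index $s$ of $L'$ there is exactly one column index $c$ with $l_{rc} = l'_{sc}$. -}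

module Defs where

open import Data.Nat using (ℕ; suc)
open import Data.Fin using (Fin; zero)
open import Data.Product using (_×_; ∃!)
open import Relation.Binary.PropositionalEquality using (_≡_)

-- A square array of order κ, with rows/columns/symbols indexed by Fin κ
-- (symbol k+1 of the paper is represented by the Fin element k).
Square : ℕ → Set
Square κ = Fin κ → Fin κ → Fin κ

IsLatin : {κ : ℕ} → Square κ → Set
IsLatin {κ} L =
  ((r s : Fin κ) → ∃! {A = Fin κ} _≡_ (λ c → L r c ≡ s)) ×
  ((c s : Fin κ) → ∃! {A = Fin κ} _≡_ (λ r → L r c ≡ s))

DiagOne : {n : ℕ} → Square (suc n) → Set
DiagOne {n} L = (r : Fin (suc n)) → L r r ≡ zero

Projective : {n : ℕ} → Square (suc n) → Square (suc n) → Set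
Projective {n} L L' =
  IsLatin L × IsLatin L' × DiagOne L × DiagOne L' ×
  ((r s : Fin (suc n)) → ∃! {A = Fin (suc n)} _≡_ (λ c → L r c ≡ L' s c))

module Submission where

-- Fix two distinct columns i and j and consider the map
--   (t , r) ↦ (L t r i , L t r j)
-- on pairs of a square index t and a row r.
-- * Its values are pairs of distinct symbols, since a row of a Latin square
--   is injective.
-- * It is injective: inside one square the column i determines the row, and
--   two rows of distinct projective squares agree in exactly one column, so
--   they cannot agree in both i and j.
-- * It hits every pair (x , y) with x ≢ y.  For each square t let r t be the
--   row carrying x in column i; then t ↦ L t (r t) j is an injection from the
--   κ - 1 squares into the κ symbols which avoids x, and a counting argument
--   (an injection Fin n → Fin n is onto) shows it reaches every y ≢ x.

open import Defs
open import Data.Nat using (ℕ; suc)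
open import Data.Nat.Properties using (1+n≰n)
open import Data.Fin using (Fin; zero; suc; punchOut; _≟_)
open import Data.Fin.Properties using (punchOut-injective; injective⇒≤; any?)
open import Data.Product using (_×_; _,_; ∃; ∃!; proj₁; proj₂)
open import Function.Definitions using (Injective)
open import Relation.Binary.PropositionalEquality
  using (_≡_; _≢_; refl; sym; trans; cong)
open import Relation.Nullary using (¬_; yes; no; contradiction)

-- An injective endomap of Fin n is onto: if y were missed, sending an extra
-- point to y would inject Fin (suc n) into Fin n.
injective⇒surjective : ∀ {n} {f : Fin n → Fin n} → Injective _≡_ _≡_ f →
                       (y : Fin n) → ∃ λ t → f t ≡ y
injective⇒surjective {n} {f} f-inj y with any? (λ t → f t ≟ y)
... | yes hit = hit
... | no  miss = contradiction (injective⇒≤ extend-injective) 1+n≰n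
  where
  extend : Fin (suc n) → Fin n
  extend zero    = y
  extend (suc t) = f t

  extend-injective : Injective _≡_ _≡_ extend
  extend-injective {zero}  {zero}  _  = refl
  extend-injective {zero}  {suc b} e  = contradiction (b , sym e) miss
  extend-injective {suc a} {zero}  e  = contradiction (a , e) miss
  extend-injective {suc a} {suc b} e  = cong suc (f-inj e)

-- An injection of Fin n into Fin (suc n) that avoids x reaches every other
-- point: removing x (via punchOut) turns it into an injective endomap.
avoiding-injection-covers : ∀ {n} {g : Fin n → Fin (suc n)} {x : Fin (suc n)} →
                            (x≢g : ∀ t → x ≢ g t) → Injective _≡_ _≡_ g →
                            (y : Fin (suc n)) → x ≢ y → ∃ λ t → g t ≡ y
avoiding-injection-covers {g = g} x≢g g-inj y x≢y =
  let t , e = injective⇒surjective squeezed-injective (punchOut x≢y)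
  in  t , punchOut-injective (x≢g t) x≢y e
  where
  squeezed-injective : Injective _≡_ _≡_ (λ t → punchOut (x≢g t))
  squeezed-injective e = g-inj (punchOut-injective (x≢g _) (x≢g _) e)

module _ {κ : ℕ} {L : Square κ} (latin : IsLatin L) where

  row-injective : ∀ r {c c'} → L r c ≡ L r c' → c ≡ c'
  row-injective r {c} e with _ , _ , unique ← proj₁ latin r (L r c)
    = trans (sym (unique refl)) (unique (sym e))

  column-injective : ∀ c {r r'} → L r c ≡ L r' c → r ≡ r'
  column-injective c {r} e with _ , _ , unique ← proj₂ latin c (L r c)
    = trans (sym (unique refl)) (unique (sym e))

  rowWith : (c s : Fin κ) → Fin κ
  rowWith c s = proj₁ (proj₂ latin c s)

  rowWith-spec : ∀ c s → L (rowWith c s) c ≡ s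
  rowWith-spec c s = proj₁ (proj₂ (proj₂ latin c s))

projective-agree-once : ∀ {n} {L L' : Square (suc n)} → Projective L L' →
                        ∀ r s {c c'} → L r c ≡ L' s c → L r c' ≡ L' s c' → c ≡ c'
projective-agree-once (_ , _ , _ , _ , meet) r s e e'
  with _ , _ , unique ← meet r s
  = trans (sym (unique e)) (unique e')

module Family {m n : ℕ} (L : Fin m → Square (suc n))
  (latin : (t : Fin m) → IsLatin (L t))
  (projective : (t u : Fin m) → t ≢ u → Projective (L t) (L u))
  {i j : Fin (suc n)} (i≢j : i ≢ j) where

  entries-distinct : ∀ t r → L t r i ≢ L t r j
  entries-distinct t r e = i≢j (row-injective (latin t) r e)

  pair-injective : ∀ {t u r s} → L t r i ≡ L u s i → L t r j ≡ L u s j →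
                   (t , r) ≡ (u , s)
  pair-injective {t} {u} ei ej with t ≟ u
  ... | yes refl = cong (t ,_) (column-injective (latin t) i ei)
  ... | no  t≢u  = contradiction (projective-agree-once (projective t u t≢u) _ _ ei ej) i≢j

  module Partner (x : Fin (suc n)) where

    partner : Fin m → Fin (suc n)
    partner t = L t (rowWith (latin t) i x) j

    partner-avoids : ∀ t → x ≢ partner t
    partner-avoids t e =
      entries-distinct t _ (trans (rowWith-spec (latin t) i x) e)

    partner-injective : Injective _≡_ _≡_ partner
    partner-injective {t} {u} e = cong proj₁ (pair-injective
      (trans (rowWith-spec (latin t) i x) (sym (rowWith-spec (latin u) i x))) e)

    partner-onto : m ≡ n → ∀ y → x ≢ y → ∃ λ t → partner t ≡ y
    partner-onto refl = avoiding-injection-covers partner-avoids partner-injective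

theorem30 : (n : ℕ) (L : Fin n → Square (suc n)) →
    ((t : Fin n) → IsLatin (L t) × DiagOne (L t)) →
    ((t u : Fin n) → ¬ t ≡ u → Projective (L t) (L u)) →
    (i j : Fin (suc n)) → ¬ i ≡ j →
    ((t : Fin n) (r : Fin (suc n)) → ¬ L t r i ≡ L t r j) ×
    ((x y : Fin (suc n)) → ¬ x ≡ y →
      ∃! {A = Fin n × Fin (suc n)} _≡_
        (λ { (t , r) → (L t r i ≡ x) × (L t r j ≡ y) }))
theorem30 n L latinDiag projective i j i≢j = entries-distinct , occurs-once
  where
  latin : (t : Fin n) → IsLatin (L t)
  latin t = proj₁ (latinDiag t)

  open Family L latin projective i≢j

  occurs-once : (x y : Fin (suc n)) → x ≢ y →
                ∃! _≡_ (λ { (t , r) → (L t r i ≡ x) × (L t r j ≡ y) })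
  occurs-once x y x≢y with t , hit ← Partner.partner-onto x refl y x≢y
    = (t , rowWith (latin t) i x) , (rowWith-spec (latin t) i x , hit) ,
      λ { (ei , ej) → pair-injective (trans (rowWith-spec (latin t) i x) (sym ei))
                                     (trans hit (sym ej)) }
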